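{- Let $(x^0\sim x^1\sim\dots\sim x^d)$ be a geodesic in $Y_{n,m}$. For every $0\leq i\leq m$, all steps of the geodesic that are shifts at position $i$ are in the same direction (all left shifts or all right shifts).
   Context: For integers $n\geq 1$, $m\geq 0$, the Yoke graph $Y_{n,m}$ has vertices the tuples $v=(v_0,\dots,v_{m+1})$ with $v_0,v_{m+1}\in\mathbb{Z}_n$, $v_1,\dots,v_m\in\{0,1\}$ and $\sum v_i\equiv0\pmod n$. An edge from $x$ to $y$ is a left shift at position $i$ ($0\leq i\leq m$) if $y_j=x_j$ for $j\notin\{i,i+1\}$, $y_i=x_i+1$ and $y_{i+1}=x_{i+1}-1$, and a right shift at position $i$ if $y_i=x_i-1$ and $y_{i+1}=x_{i+1}+1$ (bucket coordinates $0,m+1$ computed in $\mathbb{Z}_n$, all entries staying in their allowed sets); $x\sim y$ iff $y$ is obtained from $x$ by such a shift. A geodesic is a shortest path between its endpoints. -}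

module Defs where

open import Data.Nat using (ℕ; zero; suc; _+_; _∸_; _<_; _≤_; NonZero)
open import Data.Nat.DivMod using (_%_)
open import Data.Fin using (Fin; inject₁; fromℕ) renaming (zero to fz; suc to fs)
open import Data.List using (tabulate)
open import Data.Nat.ListAction using (sum)
open import Data.Empty using (⊥)
open import Data.Product using (Σ; _×_; _,_; proj₁)
open import Data.Sum using (_⊎_)
open import Relation.Binary.PropositionalEquality using (_≡_; _≢_)
open import Relation.Nullary using (¬_)

-- Coordinates of a tuple (v_0,...,v_{m+1}) are indexed by Fin (m + 2).
-- The bucket coordinates are 0 and m+1 (elements of Z_n, represented by
-- naturals < n); the middle coordinates 1..m are in {0,1}.

IsBucket : {m : ℕ} → Fin (suc (suc m)) → Set
IsBucket {m} j = (j ≡ fz) ⊎ (j ≡ fromℕ (suc m))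

module _ (n : ℕ) .{{_ : NonZero n}} (m : ℕ) where

  Coords : Set
  Coords = Fin (suc (suc m)) → ℕ

  IsVertex : Coords → Set
  IsVertex v = (v fz < n) × (v (fromℕ (suc m)) < n)
             × (∀ j → ¬ IsBucket j → v j ≤ 1)
             × (sum (tabulate v) % n ≡ 0)

  Vertex : Set
  Vertex = Σ Coords IsVertex

  coords : Vertex → Coords
  coords = proj₁

  IncAt : Fin (suc (suc m)) → ℕ → ℕ → Set
  IncAt j a b = (IsBucket j × b ≡ (a + 1) % n) ⊎ (¬ IsBucket j × a ≡ 0 × b ≡ 1)

  DecAt : Fin (suc (suc m)) → ℕ → ℕ → Set
  DecAt j a b = (IsBucket j × b ≡ (a + (n ∸ 1)) % n) ⊎ (¬ IsBucket j × a ≡ 1 × b ≡ 0)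

  OthersFixed : Fin (suc m) → Vertex → Vertex → Set
  OthersFixed i x y = ∀ j → j ≢ inject₁ i → j ≢ fs i → coords x j ≡ coords y j

  LeftShift : Fin (suc m) → Vertex → Vertex → Set
  LeftShift i x y = OthersFixed i x y
    × IncAt (inject₁ i) (coords x (inject₁ i)) (coords y (inject₁ i))
    × DecAt (fs i) (coords x (fs i)) (coords y (fs i))

  RightShift : Fin (suc m) → Vertex → Vertex → Set
  RightShift i x y = OthersFixed i x y
    × DecAt (inject₁ i) (coords x (inject₁ i)) (coords y (inject₁ i))
    × IncAt (fs i) (coords x (fs i)) (coords y (fs i))

  ShiftAt : Fin (suc m) → Vertex → Vertex → Set
  ShiftAt i x y = LeftShift i x y ⊎ RightShift i x y

  Adj : Vertex → Vertex → Set
  Adj x y = Σ (Fin (suc m)) λ i → ShiftAt i x y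

  SameVertex : Vertex → Vertex → Set
  SameVertex x y = ∀ j → coords x j ≡ coords y j

  IsWalk : (d : ℕ) → (Fin (suc d) → Vertex) → Set
  IsWalk d x = ∀ (k : Fin d) → Adj (x (inject₁ k)) (x (fs k))

  IsGeodesic : (d : ℕ) → (Fin (suc d) → Vertex) → Set
  IsGeodesic d x = IsWalk d x ×
    (∀ (e : ℕ) → e < d → (w : Fin (suc e) → Vertex) → IsWalk e w →
       SameVertex (w fz) (x fz) → SameVertex (w (fromℕ e)) (x (fromℕ d)) → ⊥)

-- Suppose a geodesic has a left and a right shift at the same position i, at steps t < t', and
-- choose such a pair with t' − t minimal over all positions.  No step strictly between
-- them is a shift at i, since it would form a closer opposite pair with one of the two.  No such
-- step touches coordinate i or i+1 either: that coordinate is then a middle one, touched only from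
-- one neighbouring position, where by minimality all shifts go the same way; so once moved it can
-- never return to the value that the shift at t' needs.  Hence coordinates i and i+1 are frozen
-- between the two shifts, and running the intermediate steps with those two coordinates kept at
-- their values before step t cancels the pair: a walk between the same endpoints, two steps shorter.
module Submission where

open import Defs
open import Data.Nat
  using (ℕ; zero; suc; NonZero; _+_; _∸_; _<_; _≤_; _≤′_; ≤′-refl; ≤′-step; z<s; s≤s; s≤s⁻¹; >-nonZero⁻¹)
open import Data.Nat.Properties
  using (≤-refl; <-cmp; <-trans; ≤-trans; <⇒≤; <⇒≱; ≤⇒≤′; ≤′⇒≤; +-suc; +-comm; +-assoc; m≤n+m; m≤m+n; m<n+m;
         +-monoˡ-≤; +-monoʳ-≤; +-monoˡ-<; +-cancelʳ-≤; m+[n∸m]≡n; m∸n+n≡m; m≤n⇒∃[o]m+o≡n)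
  renaming (_≟_ to _≟ℕ_)
open import Data.Nat.DivMod using (_%_; %-distribˡ-+; m%n%n≡m%n; [m+n]%n≡m%n; m<n⇒m%n≡m)
open import Data.Nat.Divisibility
  using (_∣_; ∣m+n∣m⇒∣n; ∣m∣n⇒∣m+n; m%n≡0⇒n∣m; n∣m⇒m%n≡0)
open import Data.Nat.ListAction using (sum)
open import Data.Nat.Tactic.RingSolver using (solve-∀)
open import Data.Fin using (Fin; inject₁; fromℕ; toℕ) renaming (zero to fz; suc to fs)
open import Data.Fin.Properties
  using (toℕ<n; toℕ-injective; inject₁-injective; suc-injective; fromℕ≢inject₁; any?; all?)
  renaming (_≟_ to _≟F_)
open import Data.List using (tabulate)
open import Data.List.Properties using (tabulate-cong)
open import Data.Empty using (⊥; ⊥-elim)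
open import Data.Product using (Σ; ∃; _×_; _,_; proj₁; proj₂)
open import Data.Sum using (_⊎_; inj₁; inj₂; [_,_]′)
open import Function using (id; _∘_)
open import Relation.Nullary using (¬_; Dec; yes; no)
open import Relation.Nullary.Decidable using (_×-dec_; _⊎-dec_; _→-dec_; ¬?)
open import Relation.Binary.Definitions using (tri<; tri≈; tri>)
open import Relation.Binary.PropositionalEquality
  using (_≡_; _≢_; refl; sym; trans; cong; subst; subst₂; module ≡-Reasoning)

sum-tabulate-+ : ∀ {k} (f g : Fin k → ℕ) →
  sum (tabulate (λ c → f c + g c)) ≡ sum (tabulate f) + sum (tabulate g)
sum-tabulate-+ {zero} f g = refl
sum-tabulate-+ {suc k} f g = trans
  (cong (f fz + g fz +_) (sum-tabulate-+ (f ∘ fs) (g ∘ fs)))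
  (interchange (f fz) (g fz) (sum (tabulate (f ∘ fs))) (sum (tabulate (g ∘ fs))))
  where
    interchange : ∀ a b c e → a + b + (c + e) ≡ a + c + (b + e)
    interchange = solve-∀

[[m+u]%n+v]%n≡m : ∀ {m u v} n .{{_ : NonZero n}} → m < n → u + v ≡ n → ((m + u) % n + v) % n ≡ m
[[m+u]%n+v]%n≡m {m} {u} {v} n m<n u+v≡n = begin
  ((m + u) % n + v) % n           ≡⟨ %-distribˡ-+ ((m + u) % n) v n ⟩
  ((m + u) % n % n + v % n) % n   ≡⟨ cong (λ a → (a + v % n) % n) (m%n%n≡m%n (m + u) n) ⟩
  ((m + u) % n + v % n) % n       ≡⟨ %-distribˡ-+ (m + u) v n ⟨
  (m + u + v) % n                 ≡⟨ cong (_% n) (trans (+-assoc m u v) (cong (m +_) u+v≡n)) ⟩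
  (m + n) % n                     ≡⟨ [m+n]%n≡m%n m n ⟩
  m % n                           ≡⟨ m<n⇒m%n≡m m<n ⟩
  m                               ∎
  where open ≡-Reasoning

m<n⇒∃[k]1+k+m≡n : ∀ {m n} → m < n → ∃ λ k → suc (k + m) ≡ n
m<n⇒∃[k]1+k+m≡n {m} m<n with m≤n⇒∃[o]m+o≡n m<n
... | k , 1+m+k≡n = k , trans (cong suc (+-comm k m)) 1+m+k≡n

interval-invariant : ∀ {u v} (Q : ℕ → Set) → (∀ {w} → u ≤ w → w < v → Q w → Q (suc w)) →
  u ≤ v → Q u → Q v
interval-invariant {u} {v} Q step u≤v Qu = go (≤⇒≤′ u≤v) ≤-refl
  where
    go : ∀ {w} → u ≤′ w → w ≤ v → Q w
    go ≤′-refl _ = Qu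
    go (≤′-step u≤′w) w<v = step (≤′⇒≤ u≤′w) w<v (go u≤′w (<⇒≤ w<v))

-- min t d, used to read a walk indexed by Fin (suc d) as one indexed by ℕ.
clamp : ∀ d → ℕ → Fin (suc d)
clamp d zero = fz
clamp zero (suc t) = fz
clamp (suc d) (suc t) = fs (clamp d t)

clamp-toℕ : ∀ d (k : Fin (suc d)) → clamp d (toℕ k) ≡ k
clamp-toℕ d fz = refl
clamp-toℕ (suc d) (fs k) = cong fs (clamp-toℕ d k)

clamp-inject₁ : ∀ {d t} → t ≤ d → clamp (suc d) t ≡ inject₁ (clamp d t)
clamp-inject₁ {t = zero} _ = refl
clamp-inject₁ {suc d} {suc t} (s≤s t≤d) = cong fs (clamp-inject₁ t≤d)

clamp-self : ∀ d → clamp d d ≡ fromℕ d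
clamp-self zero = refl
clamp-self (suc d) = cong fs (clamp-self d)

module YokeGraph (n : ℕ) .{{_ : NonZero n}} (m : ℕ) where

  V : Set
  V = Vertex n m

  coord : V → Fin (suc (suc m)) → ℕ
  coord = coords n m

  private
    variable
      c : Fin (suc (suc m))
      i p q : Fin (suc m)
      u v w e f : ℕ
      a a' b b' y y' z z' : V

  -- A record, so that its endpoints can be inferred (SameVertex unfolds to a Π-type).
  infix 4 _≈_
  record _≈_ (a b : V) : Set where
    constructor mk≈
    field ≈⇒SameVertex : SameVertex n m a b
  open _≈_

  ≈-refl : a ≈ a
  ≈-refl = mk≈ λ _ → refl

  ≈-trans : a ≈ b → b ≈ b' → a ≈ b'
  ≈-trans (mk≈ a≈b) (mk≈ b≈b') = mk≈ λ c → trans (a≈b c) (b≈b' c)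

  bucket-bound : (x : V) → IsBucket c → coord x c < n
  bucket-bound (_ , x₀<n , _) (inj₁ refl) = x₀<n
  bucket-bound (_ , _ , xₘ<n , _) (inj₂ refl) = xₘ<n

  sum-divisible : (x : V) → n ∣ sum (tabulate (coord x))
  sum-divisible (_ , _ , _ , _ , x-sum) = m%n≡0⇒n∣m _ n x-sum

  Touches : Fin (suc m) → Fin (suc (suc m)) → Set
  Touches p c = c ≡ inject₁ p ⊎ c ≡ fs p

  touches? : ∀ p c → Dec (Touches p c)
  touches? p c = (c ≟F inject₁ p) ⊎-dec (c ≟F fs p)

  Disjoint : Fin (suc m) → Fin (suc m) → Set
  Disjoint i j = ∀ c → Touches i c → ¬ Touches j c

  ShiftAt⇒OthersFixed : ShiftAt n m p y y' → OthersFixed n m p y y'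
  ShiftAt⇒OthersFixed (inj₁ (fixed , _)) = fixed
  ShiftAt⇒OthersFixed (inj₂ (fixed , _)) = fixed

  ShiftAt-untouched : ShiftAt n m p y y' → ¬ Touches p c → coord y c ≡ coord y' c
  ShiftAt-untouched {p = p} {y = y} {y' = y'} {c = c} shift ¬touch =
    ShiftAt⇒OthersFixed {p = p} {y = y} {y' = y'} shift c (¬touch ∘ inj₁) (¬touch ∘ inj₂)

  ShiftAt-transfer : ShiftAt n m p y y' →
    (∀ c → Touches p c → coord z c ≡ coord y c) → (∀ c → Touches p c → coord z' c ≡ coord y' c) →
    OthersFixed n m p z z' → ShiftAt n m p z z'
  ShiftAt-transfer {p} (inj₁ (_ , inc , dec)) before after fixed = inj₁ (fixed ,
    subst₂ (IncAt n m (inject₁ p)) (sym (before _ (inj₁ refl))) (sym (after _ (inj₁ refl))) inc ,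
    subst₂ (DecAt n m (fs p)) (sym (before _ (inj₂ refl))) (sym (after _ (inj₂ refl))) dec)
  ShiftAt-transfer {p} (inj₂ (_ , dec , inc)) before after fixed = inj₂ (fixed ,
    subst₂ (DecAt n m (inject₁ p)) (sym (before _ (inj₁ refl))) (sym (after _ (inj₁ refl))) dec ,
    subst₂ (IncAt n m (fs p)) (sym (before _ (inj₂ refl))) (sym (after _ (inj₂ refl))) inc)

  Adj-respˡ : a ≈ a' → Adj n m a' b → Adj n m a b
  Adj-respˡ {a} {a'} {b} (mk≈ a≈a') (p , shift) =
    p , ShiftAt-transfer {y = a'} {y' = b} {z = a} {z' = b} shift (λ c _ → a≈a' c) (λ _ _ → refl)
      (λ c c≢ c≢′ → trans (a≈a' c) (ShiftAt⇒OthersFixed {y = a'} {y' = b} shift c c≢ c≢′))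

  IncAt-middle : ¬ IsBucket c → IncAt n m c u v → u ≡ 0 × v ≡ 1
  IncAt-middle middle (inj₁ (bucket , _)) = ⊥-elim (middle bucket)
  IncAt-middle middle (inj₂ (_ , u≡0 , v≡1)) = u≡0 , v≡1

  DecAt-middle : ¬ IsBucket c → DecAt n m c u v → u ≡ 1 × v ≡ 0
  DecAt-middle middle (inj₁ (bucket , _)) = ⊥-elim (middle bucket)
  DecAt-middle middle (inj₂ (_ , u≡1 , v≡0)) = u≡1 , v≡0

  IncAt-DecAt-cancel : (IsBucket c → u < n) → IncAt n m c u v → DecAt n m c v w → w ≡ u
  IncAt-DecAt-cancel u<n (inj₁ (bucket , refl)) (inj₁ (_ , refl)) =
    [[m+u]%n+v]%n≡m n (u<n bucket) (m+[n∸m]≡n (>-nonZero⁻¹ n))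
  IncAt-DecAt-cancel _ (inj₁ (bucket , _)) (inj₂ (middle , _)) = ⊥-elim (middle bucket)
  IncAt-DecAt-cancel _ (inj₂ (middle , _)) (inj₁ (bucket , _)) = ⊥-elim (middle bucket)
  IncAt-DecAt-cancel _ (inj₂ (_ , u≡0 , _)) (inj₂ (_ , _ , w≡0)) = trans w≡0 (sym u≡0)

  DecAt-IncAt-cancel : (IsBucket c → u < n) → DecAt n m c u v → IncAt n m c v w → w ≡ u
  DecAt-IncAt-cancel u<n (inj₁ (bucket , refl)) (inj₁ (_ , refl)) =
    [[m+u]%n+v]%n≡m n (u<n bucket) (m∸n+n≡m (>-nonZero⁻¹ n))
  DecAt-IncAt-cancel _ (inj₁ (bucket , _)) (inj₂ (middle , _)) = ⊥-elim (middle bucket)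
  DecAt-IncAt-cancel _ (inj₂ (middle , _)) (inj₁ (bucket , _)) = ⊥-elim (middle bucket)
  DecAt-IncAt-cancel _ (inj₂ (_ , u≡1 , _)) (inj₂ (_ , _ , w≡1)) = trans w≡1 (sym u≡1)

  inject₁≡fs⇒¬IsBucket : c ≡ inject₁ p → c ≡ fs q → ¬ IsBucket c
  inject₁≡fs⇒¬IsBucket c≡p c≡q (inj₁ c≡fz) with trans (sym c≡q) c≡fz
  ... | ()
  inject₁≡fs⇒¬IsBucket c≡p _ (inj₂ c≡top) = fromℕ≢inject₁ (trans (sym c≡top) c≡p)

  fs-side : c ≡ inject₁ i → Touches p c → p ≢ i → c ≡ fs p
  fs-side c≡i (inj₁ c≡p) p≢i = ⊥-elim (p≢i (inject₁-injective (trans (sym c≡p) c≡i)))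
  fs-side _ (inj₂ c≡p) _ = c≡p

  inject₁-side : c ≡ fs i → Touches p c → p ≢ i → c ≡ inject₁ p
  inject₁-side _ (inj₁ c≡p) _ = c≡p
  inject₁-side c≡i (inj₂ c≡p) p≢i = ⊥-elim (p≢i (suc-injective (trans (sym c≡p) c≡i)))

  shared-touch⇒¬IsBucket : Touches i c → Touches p c → p ≢ i → ¬ IsBucket c
  shared-touch⇒¬IsBucket (inj₁ c≡i) touch p≢i =
    inject₁≡fs⇒¬IsBucket c≡i (fs-side c≡i touch p≢i)
  shared-touch⇒¬IsBucket (inj₂ c≡i) touch p≢i =
    inject₁≡fs⇒¬IsBucket (inject₁-side c≡i touch p≢i) c≡i

  other-toucher-unique : Touches i c → Touches p c → Touches q c → p ≢ i → q ≢ i → p ≡ q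
  other-toucher-unique (inj₁ c≡i) tp tq p≢i q≢i =
    suc-injective (trans (sym (fs-side c≡i tp p≢i)) (fs-side c≡i tq q≢i))
  other-toucher-unique (inj₂ c≡i) tp tq p≢i q≢i =
    inject₁-injective (trans (sym (inject₁-side c≡i tp p≢i)) (inject₁-side c≡i tq q≢i))

  data OppositeShifts (i : Fin (suc m)) (y y' z z' : V) : Set where
    left-right : LeftShift n m i y y' → RightShift n m i z z' → OppositeShifts i y y' z z'
    right-left : RightShift n m i y y' → LeftShift n m i z z' → OppositeShifts i y y' z z'

  OppositeShifts⇒ShiftAtˡ : OppositeShifts i y y' z z' → ShiftAt n m i y y'
  OppositeShifts⇒ShiftAtˡ (left-right left _) = inj₁ left
  OppositeShifts⇒ShiftAtˡ (right-left right _) = inj₂ right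

  OppositeShifts⇒ShiftAtʳ : OppositeShifts i y y' z z' → ShiftAt n m i z z'
  OppositeShifts⇒ShiftAtʳ (left-right _ right) = inj₂ right
  OppositeShifts⇒ShiftAtʳ (right-left _ left) = inj₁ left

  OppositeShifts-split : OppositeShifts i y y' z z' → ShiftAt n m i a b →
    OppositeShifts i y y' a b ⊎ OppositeShifts i a b z z'
  OppositeShifts-split (left-right left right) (inj₁ left′) = inj₂ (left-right left′ right)
  OppositeShifts-split (left-right left right) (inj₂ right′) = inj₁ (left-right left right′)
  OppositeShifts-split (right-left right left) (inj₁ left′) = inj₁ (right-left right left′)
  OppositeShifts-split (right-left right left) (inj₂ right′) = inj₂ (right-left right′ left)

  IncAt-changes : ¬ IsBucket c → IncAt n m c u v → u ≢ v
  IncAt-changes middle inc u≡v with IncAt-middle middle inc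
  ... | u≡0 , v≡1 with trans (sym u≡0) (trans u≡v v≡1)
  ... | ()

  DecAt-changes : ¬ IsBucket c → DecAt n m c u v → u ≢ v
  DecAt-changes middle dec u≡v with DecAt-middle middle dec
  ... | u≡1 , v≡0 with trans (sym v≡0) (trans (sym u≡v) u≡1)
  ... | ()

  ShiftAt-changes : ¬ IsBucket c → Touches p c → ShiftAt n m p y y' → coord y c ≢ coord y' c
  ShiftAt-changes middle (inj₁ refl) (inj₁ (_ , inc , _)) = IncAt-changes middle inc
  ShiftAt-changes middle (inj₂ refl) (inj₁ (_ , _ , dec)) = DecAt-changes middle dec
  ShiftAt-changes middle (inj₁ refl) (inj₂ (_ , dec , _)) = DecAt-changes middle dec
  ShiftAt-changes middle (inj₂ refl) (inj₂ (_ , _ , inc)) = IncAt-changes middle inc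

  same-direction-post-agree : ¬ IsBucket c → Touches p c → ShiftAt n m p y y' → ShiftAt n m p z z' →
    ¬ OppositeShifts p y y' z z' → coord y' c ≡ coord z' c
  same-direction-post-agree middle (inj₁ refl) (inj₁ (_ , inc , _)) (inj₁ (_ , inc′ , _)) _ =
    trans (proj₂ (IncAt-middle middle inc)) (sym (proj₂ (IncAt-middle middle inc′)))
  same-direction-post-agree middle (inj₂ refl) (inj₁ (_ , _ , dec)) (inj₁ (_ , _ , dec′)) _ =
    trans (proj₂ (DecAt-middle middle dec)) (sym (proj₂ (DecAt-middle middle dec′)))
  same-direction-post-agree middle (inj₁ refl) (inj₂ (_ , dec , _)) (inj₂ (_ , dec′ , _)) _ =
    trans (proj₂ (DecAt-middle middle dec)) (sym (proj₂ (DecAt-middle middle dec′)))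
  same-direction-post-agree middle (inj₂ refl) (inj₂ (_ , _ , inc)) (inj₂ (_ , _ , inc′)) _ =
    trans (proj₂ (IncAt-middle middle inc)) (sym (proj₂ (IncAt-middle middle inc′)))
  same-direction-post-agree _ _ (inj₁ left) (inj₂ right) not-opposite =
    ⊥-elim (not-opposite (left-right left right))
  same-direction-post-agree _ _ (inj₂ right) (inj₁ left) not-opposite =
    ⊥-elim (not-opposite (right-left right left))

  OppositeShifts-post≡pre : ¬ IsBucket c → Touches i c → OppositeShifts i y y' z z' →
    coord y' c ≡ coord z c
  OppositeShifts-post≡pre middle (inj₁ refl) (left-right (_ , inc , _) (_ , dec , _)) =
    trans (proj₂ (IncAt-middle middle inc)) (sym (proj₁ (DecAt-middle middle dec)))
  OppositeShifts-post≡pre middle (inj₂ refl) (left-right (_ , _ , dec) (_ , _ , inc)) =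
    trans (proj₂ (DecAt-middle middle dec)) (sym (proj₁ (IncAt-middle middle inc)))
  OppositeShifts-post≡pre middle (inj₁ refl) (right-left (_ , dec , _) (_ , inc , _)) =
    trans (proj₂ (DecAt-middle middle dec)) (sym (proj₁ (IncAt-middle middle inc)))
  OppositeShifts-post≡pre middle (inj₂ refl) (right-left (_ , _ , inc) (_ , _ , dec)) =
    trans (proj₂ (IncAt-middle middle inc)) (sym (proj₁ (DecAt-middle middle dec)))

  OppositeShifts-cancel : OppositeShifts i y y' z z' → (∀ c → Touches i c → coord z c ≡ coord y' c) →
    Touches i c → coord z' c ≡ coord y c
  OppositeShifts-cancel {y = y} {z' = z'} (left-right (_ , inc , _) (_ , dec , _)) agree (inj₁ refl) =
    IncAt-DecAt-cancel (bucket-bound y) inc (subst (λ x → DecAt n m _ x (coord z' _)) (agree _ (inj₁ refl)) dec)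
  OppositeShifts-cancel {y = y} {z' = z'} (left-right (_ , _ , dec) (_ , _ , inc)) agree (inj₂ refl) =
    DecAt-IncAt-cancel (bucket-bound y) dec (subst (λ x → IncAt n m _ x (coord z' _)) (agree _ (inj₂ refl)) inc)
  OppositeShifts-cancel {y = y} {z' = z'} (right-left (_ , dec , _) (_ , inc , _)) agree (inj₁ refl) =
    DecAt-IncAt-cancel (bucket-bound y) dec (subst (λ x → IncAt n m _ x (coord z' _)) (agree _ (inj₁ refl)) inc)
  OppositeShifts-cancel {y = y} {z' = z'} (right-left (_ , _ , inc) (_ , _ , dec)) agree (inj₂ refl) =
    IncAt-DecAt-cancel (bucket-bound y) inc (subst (λ x → DecAt n m _ x (coord z' _)) (agree _ (inj₂ refl)) dec)

  infixr 5 _∷_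
  data Path : V → V → ℕ → Set where
    [_] : a ≈ b → Path a b 0
    _∷_ : Adj n m a b → Path b b' e → Path a b' (suc e)

  path-from-steps : (Z : ℕ → V) (e : ℕ) → (∀ {s} → s < e → Adj n m (Z s) (Z (suc s))) →
    Path (Z 0) (Z e) e
  path-from-steps Z zero _ = [ ≈-refl ]
  path-from-steps Z (suc e) step = step z<s ∷ path-from-steps (Z ∘ suc) e (λ s<e → step (s≤s s<e))

  ≈-path : a ≈ a' → Path a' b e → Path a b e
  ≈-path a≈a' [ a'≈b ] = [ ≈-trans a≈a' a'≈b ]
  ≈-path a≈a' (_∷_ {b = b} step π) = Adj-respˡ {b = b} a≈a' step ∷ π

  path-≈ : Path a b e → b ≈ b' → Path a b' e
  path-≈ [ a≈b ] b≈b' = [ ≈-trans a≈b b≈b' ]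
  path-≈ (step ∷ π) b≈b' = step ∷ path-≈ π b≈b'

  infixr 5 _++_
  _++_ : Path a b e → Path b b' f → Path a b' (e + f)
  [ a≈b ] ++ ρ = ≈-path a≈b ρ
  (step ∷ π) ++ ρ = step ∷ (π ++ ρ)

  vertices : Path a b e → Fin (suc e) → V
  vertices {a} _ fz = a
  vertices [ _ ] (fs ())
  vertices (_ ∷ π) (fs k) = vertices π k

  vertices-walk : (π : Path a b e) → IsWalk n m e (vertices π)
  vertices-walk (step ∷ π) fz = step
  vertices-walk (_ ∷ π) (fs k) = vertices-walk π k

  vertices-end : (π : Path a b e) → vertices π (fromℕ e) ≈ b
  vertices-end [ a≈b ] = a≈b
  vertices-end (_ ∷ π) = vertices-end π

  -- patch y is y with coordinates i and i+1 taken from p.  If p → q is a shift at i and y agrees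
  -- with q on those coordinates, this undoes that shift inside y.
  module Patch (i : Fin (suc m)) (p q : V) (p≡q-off : ∀ c → ¬ Touches i c → coord p c ≡ coord q c) where

    Agrees : V → Set
    Agrees y = ∀ c → Touches i c → coord y c ≡ coord q c

    patched : V → Coords n m
    patched y c with touches? i c
    ... | yes _ = coord p c
    ... | no _ = coord y c

    patched-elim : (P : ℕ → Set) → (Touches i c → P (coord p c)) → (¬ Touches i c → P (coord y c)) →
      P (patched y c)
    patched-elim {c = c} P on off with touches? i c
    ... | yes touch = on touch
    ... | no ¬touch = off ¬touch

    patched-sum : (y : V) → Agrees y →
      sum (tabulate (coord q)) + sum (tabulate (patched y)) ≡ sum (tabulate (coord y)) + sum (tabulate (coord p))
    patched-sum y agrees = begin
      sum (tabulate (coord q)) + sum (tabulate (patched y))  ≡⟨ sum-tabulate-+ (coord q) (patched y) ⟨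
      sum (tabulate (λ c → coord q c + patched y c))         ≡⟨ cong sum (tabulate-cong pointwise) ⟩
      sum (tabulate (λ c → coord y c + coord p c))           ≡⟨ sum-tabulate-+ (coord y) (coord p) ⟩
      sum (tabulate (coord y)) + sum (tabulate (coord p))    ∎
      where
        open ≡-Reasoning
        pointwise : ∀ c → coord q c + patched y c ≡ coord y c + coord p c
        pointwise c = patched-elim {c = c} {y = y} (λ x → coord q c + x ≡ coord y c + coord p c)
          (λ touch → cong (_+ coord p c) (sym (agrees c touch)))
          (λ ¬touch → trans (+-comm (coord q c) (coord y c)) (cong (coord y c +_) (sym (p≡q-off c ¬touch))))

    patch : (y : V) → Agrees y → V
    patch y agrees = patched y , patched-vertex (proj₂ p) (proj₂ y)
      where
        patched-vertex : IsVertex n m (coord p) → IsVertex n m (coord y) → IsVertex n m (patched y)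
        patched-vertex (p₀<n , pₘ<n , p-middle , _) (y₀<n , yₘ<n , y-middle , _) =
          patched-elim {y = y} (_< n) (λ _ → p₀<n) (λ _ → y₀<n) ,
          patched-elim {y = y} (_< n) (λ _ → pₘ<n) (λ _ → yₘ<n) ,
          (λ c middle → patched-elim {y = y} (_≤ 1) (λ _ → p-middle c middle) (λ _ → y-middle c middle)) ,
          n∣m⇒m%n≡0 _ n (∣m+n∣m⇒∣n
            (subst (n ∣_) (sym (patched-sum y agrees)) (∣m∣n⇒∣m+n (sum-divisible y) (sum-divisible p)))
            (sum-divisible q))

    patch-off : ∀ {y agrees} → ¬ Touches i c → coord (patch y agrees) c ≡ coord y c
    patch-off {c = c} {y = y} ¬touch =
      patched-elim {c = c} {y = y} (_≡ coord y c) (⊥-elim ∘ ¬touch) (λ _ → refl)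

    Agrees-step : ∀ {j} → Disjoint i j → ShiftAt n m j y y' → Agrees y → Agrees y'
    Agrees-step {y = y} {y' = y'} disjoint shift agrees c touch =
      trans (sym (ShiftAt-untouched {y = y} {y' = y'} shift (disjoint c touch))) (agrees c touch)

    patch-shift : ∀ {j} → Disjoint i j → ShiftAt n m j y y' → (agrees : Agrees y) (agrees' : Agrees y') →
      ShiftAt n m j (patch y agrees) (patch y' agrees')
    patch-shift {y = y} {y' = y'} {j = j} disjoint shift agrees agrees' =
      ShiftAt-transfer {y = y} {y' = y'} {z = patch y agrees} {z' = patch y' agrees'} shift
        (λ c touch → patch-off {y = y} {agrees = agrees} (away c touch))
        (λ c touch → patch-off {y = y'} {agrees = agrees'} (away c touch))
        fixed
      where
        away : ∀ c → Touches j c → ¬ Touches i c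
        away c touchʲ touchⁱ = disjoint c touchⁱ touchʲ
        fixed : OthersFixed n m j (patch y agrees) (patch y' agrees')
        fixed c c≢ c≢′ with touches? i c
        ... | yes _ = refl
        ... | no _ = ShiftAt⇒OthersFixed {y = y} {y' = y'} shift c c≢ c≢′

    patch-path : (Z : ℕ → V) (e : ℕ) →
      (∀ {s} → s < e → Σ (Fin (suc m)) λ j → Disjoint i j × ShiftAt n m j (Z s) (Z (suc s))) →
      (agrees : Agrees (Z 0)) (agrees' : Agrees (Z e)) → Path (patch (Z 0) agrees) (patch (Z e) agrees') e
    patch-path Z zero _ _ _ = [ mk≈ (λ _ → refl) ]
    patch-path Z (suc e) steps agrees agrees' with steps z<s
    ... | j , disjoint , shift =
      (j , patch-shift disjoint shift agrees agrees₁) ∷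
      patch-path (Z ∘ suc) e (λ s<e → steps (s≤s s<e)) agrees₁ agrees'
      where
        agrees₁ : Agrees (Z 1)
        agrees₁ = Agrees-step {y = Z 0} {y' = Z 1} disjoint shift agrees

  IsBucket? : (c : Fin (suc (suc m))) → Dec (IsBucket c)
  IsBucket? c = (c ≟F fz) ⊎-dec (c ≟F fromℕ (suc m))

  IncAt? : ∀ c u v → Dec (IncAt n m c u v)
  IncAt? c u v =
    (IsBucket? c ×-dec v ≟ℕ (u + 1) % n) ⊎-dec (¬? (IsBucket? c) ×-dec u ≟ℕ 0 ×-dec v ≟ℕ 1)

  DecAt? : ∀ c u v → Dec (DecAt n m c u v)
  DecAt? c u v =
    (IsBucket? c ×-dec v ≟ℕ (u + (n ∸ 1)) % n) ⊎-dec (¬? (IsBucket? c) ×-dec u ≟ℕ 1 ×-dec v ≟ℕ 0)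

  OthersFixed? : ∀ p y y' → Dec (OthersFixed n m p y y')
  OthersFixed? p y y' =
    all? λ c → ¬? (c ≟F inject₁ p) →-dec ¬? (c ≟F fs p) →-dec coord y c ≟ℕ coord y' c

  RightShift? : ∀ p y y' → Dec (RightShift n m p y y')
  RightShift? p y y' = OthersFixed? p y y' ×-dec DecAt? _ _ _ ×-dec IncAt? _ _ _

  module ShortestWalk (d : ℕ) (X : ℕ → V) (pos : ℕ → Fin (suc m))
    (shift : ∀ {t} → t < d → ShiftAt n m (pos t) (X t) (X (suc t)))
    (shortest : ∀ {e} → e < d → ¬ Path (X 0) (X d) e) where

    Opposite : Fin (suc m) → ℕ → ℕ → Set
    Opposite i t t' = OppositeShifts i (X t) (X (suc t)) (X t') (X (suc t'))

    step : ∀ {t} → t < d → Adj n m (X t) (X (suc t))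
    step t<d = pos _ , shift t<d

    opposite-bypass : ∀ {i t k} → suc (k + t) < d → Opposite i t (suc (k + t)) →
      (∀ {u} → t < u → u < suc (k + t) → Disjoint i (pos u)) → Path (X t) (X (suc (suc (k + t)))) k
    opposite-bypass {i} {t} {k} t'<d opposite disjoint = ≈-path enter (path-≈ middle leave)
      where
        t' : ℕ
        t' = suc (k + t)
        before<d : ∀ {u} → u < t' → u < d
        before<d u<t' = <-trans u<t' t'<d
        first-fixed : ∀ c → ¬ Touches i c → coord (X t) c ≡ coord (X (suc t)) c
        first-fixed c = ShiftAt-untouched {p = i} {y = X t} {y' = X (suc t)} (OppositeShifts⇒ShiftAtˡ opposite)
        open Patch i (X t) (X (suc t)) first-fixed
        agrees-first : Agrees (X (suc t))
        agrees-first _ _ = refl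
        agrees-last : Agrees (X t')
        agrees-last = interval-invariant (Agrees ∘ X)
          (λ t<w w<t' → Agrees-step {y = X _} {y' = X (suc _)} (disjoint t<w w<t') (shift (before<d w<t')))
          (s≤s (m≤n+m t k)) agrees-first
        middle : Path (patch (X (suc t)) agrees-first) (patch (X t') agrees-last) k
        middle = patch-path (λ s → X (suc (s + t))) k
          (λ {s} s<k → pos (suc (s + t)) , disjoint (s≤s (m≤n+m t s)) (s≤s (+-monoˡ-< t s<k)) ,
                       shift (before<d (s≤s (+-monoˡ-< t s<k))))
          agrees-first agrees-last
        enter : X t ≈ patch (X (suc t)) agrees-first
        enter = mk≈ λ c →
          patched-elim {c = c} {y = X (suc t)} (coord (X t) c ≡_) (λ _ → refl) (first-fixed c)
        leave : patch (X t') agrees-last ≈ X (suc t')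
        leave = mk≈ λ c → patched-elim {c = c} {y = X t'} (_≡ coord (X (suc t')) c)
          (λ touch → sym (OppositeShifts-cancel opposite agrees-last touch))
          (ShiftAt-untouched {p = i} {y = X t'} {y' = X (suc t')} (OppositeShifts⇒ShiftAtʳ opposite))

    opposite-shortcut : ∀ {i t k} → suc (k + t) < d → Opposite i t (suc (k + t)) →
      (∀ {u} → t < u → u < suc (k + t) → Disjoint i (pos u)) → ⊥
    opposite-shortcut {i} {t} {k} t'<d opposite disjoint with m≤n⇒∃[o]m+o≡n t'<d
    ... | r , 2+k+t+r≡d = shortest shorter (subst (λ v → Path (X 0) (X v) (t + (k + r))) d≡ shortcut)
      where
        d≡ : r + suc (suc (k + t)) ≡ d
        d≡ = trans (+-comm r _) 2+k+t+r≡d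
        prefix : Path (X 0) (X t) t
        prefix = path-from-steps X t (λ s<t → step (<-trans s<t (<-trans (s≤s (m≤n+m t k)) t'<d)))
        suffix : Path (X (suc (suc (k + t)))) (X (r + suc (suc (k + t)))) r
        suffix = path-from-steps (λ s → X (s + suc (suc (k + t)))) r
          (λ {s} s<r → step (subst (s + suc (suc (k + t)) <_) d≡ (+-monoˡ-< (suc (suc (k + t))) s<r)))
        shortcut : Path (X 0) (X (r + suc (suc (k + t)))) (t + (k + r))
        shortcut = prefix ++ opposite-bypass t'<d opposite disjoint ++ suffix
        shorter : t + (k + r) < d
        shorter = subst (t + (k + r) <_) (trans (rearrange t k r) d≡) (m<n+m (t + (k + r)) {2} z<s)
          where rearrange : ∀ t k r → 2 + (t + (k + r)) ≡ r + suc (suc (k + t))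
                rearrange = solve-∀

    NoOppositeWithin : ℕ → Set
    NoOppositeWithin g = ∀ {i u v} → u < v → v ≤ g + u → v < d → ¬ Opposite i u v

    NoOppositeWithin-mono : ∀ {g h} → h ≤ g → NoOppositeWithin g → NoOppositeWithin h
    NoOppositeWithin-mono h≤g none u<v v≤h+u = none u<v (≤-trans v≤h+u (+-monoˡ-≤ _ h≤g))

    module Innermost {i t k} (no-closer : NoOppositeWithin k) (t'<d : suc (k + t) < d)
                     (opposite : Opposite i t (suc (k + t))) where

      t' : ℕ
      t' = suc (k + t)

      Between : ℕ → Set
      Between u = t < u × u < t'

      between<d : Between u → u < d
      between<d (_ , u<t') = <-trans u<t' t'<d

      shift-at : Between u → pos u ≡ p → ShiftAt n m p (X u) (X (suc u))
      shift-at between refl = shift (between<d between)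

      closer : Between u → Between w → u < w → ¬ Opposite p u w
      closer (t<u , _) (_ , w<t') u<w =
        no-closer u<w (≤-trans (s≤s⁻¹ w<t') (+-monoʳ-≤ k (<⇒≤ t<u))) (<-trans w<t' t'<d)

      pos-between-≢ : Between u → pos u ≢ i
      pos-between-≢ {u} between@(t<u , u<t') pos≡i with OppositeShifts-split opposite (shift-at between pos≡i)
      ... | inj₁ first-half = no-closer t<u (s≤s⁻¹ u<t') (between<d between) first-half
      ... | inj₂ second-half = no-closer u<t' (subst (_≤ k + u) (+-suc k t) (+-monoʳ-≤ k t<u)) t'<d second-half

      post-agree-between : ¬ IsBucket c → Touches p c → Between u → Between w → pos u ≡ p → pos w ≡ p →
        coord (X (suc u)) c ≡ coord (X (suc w)) c
      post-agree-between {u = u} {w = w} middle touch bu bw pos-u pos-w with <-cmp u w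
      ... | tri< u<w _ _ =
        same-direction-post-agree middle touch (shift-at bu pos-u) (shift-at bw pos-w) (closer bu bw u<w)
      ... | tri≈ _ refl _ = refl
      ... | tri> _ _ w<u =
        sym (same-direction-post-agree middle touch (shift-at bw pos-w) (shift-at bu pos-u) (closer bw bu w<u))

      -- Once c has its value just after u₀, every step between t and t' keeps it: later touches of c
      -- are same-direction shifts from the same position.  That value is also the one the shift at t'
      -- starts from, hence the one just after t; so c has it already before u₀, which u₀ must change.
      untouched-between : Touches i c → Between u → ¬ Touches (pos u) c
      untouched-between {c} {u₀} touchᵢ between₀@(t<u₀ , u₀<t') touch₀ =
        ShiftAt-changes {y = X u₀} {y' = X (suc u₀)} middle touch₀ (shift (between<d between₀)) at-u₀
        where
          middle : ¬ IsBucket c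
          middle = shared-touch⇒¬IsBucket touchᵢ touch₀ (pos-between-≢ between₀)
          Q : ℕ → Set
          Q w = coord (X w) c ≡ coord (X (suc u₀)) c
          preserve : Between w → Q w → Q (suc w)
          preserve {w} between Qw with touches? (pos w) c
          ... | yes touch = post-agree-between middle touch₀ between between₀
                  (other-toucher-unique touchᵢ touch touch₀ (pos-between-≢ between) (pos-between-≢ between₀))
                  refl
          ... | no ¬touch =
                  trans (sym (ShiftAt-untouched {y = X w} {y' = X (suc w)} (shift (between<d between)) ¬touch)) Qw
          at-t' : Q t'
          at-t' = interval-invariant Q (λ u₀<w w<t' → preserve (<-trans t<u₀ u₀<w , w<t')) u₀<t' refl
          at-u₀ : Q u₀
          at-u₀ = interval-invariant Q (λ t<w w<u₀ → preserve (t<w , <-trans w<u₀ u₀<t')) t<u₀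
            (trans (OppositeShifts-post≡pre middle touchᵢ opposite) at-t')

      impossible : ⊥
      impossible =
        opposite-shortcut t'<d opposite (λ t<u u<t' c touchᵢ → untouched-between touchᵢ (t<u , u<t'))

    no-opposite-within : ∀ g → NoOppositeWithin g
    no-opposite-within zero u<v v≤u _ _ = <⇒≱ u<v v≤u
    no-opposite-within (suc g) {u = u} u<v v≤ v<d opposite with m<n⇒∃[k]1+k+m≡n u<v
    ... | k , refl = Innermost.impossible
      (NoOppositeWithin-mono (+-cancelʳ-≤ u k g (s≤s⁻¹ v≤)) (no-opposite-within g)) v<d opposite

    left-right-same-time : u < d → v < d →
      LeftShift n m i (X u) (X (suc u)) → RightShift n m i (X v) (X (suc v)) → u ≡ v
    left-right-same-time {u} {v} u<d v<d left right with <-cmp u v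
    ... | tri< u<v _ _ = ⊥-elim (no-opposite-within v u<v (m≤m+n v u) v<d (left-right left right))
    ... | tri≈ _ u≡v _ = u≡v
    ... | tri> _ _ v<u = ⊥-elim (no-opposite-within u v<u (m≤m+n u v) u<d (right-left right left))

  module Geodesic (d : ℕ) (x : Fin (suc (suc d)) → V) (geodesic : IsGeodesic n m (suc d) x) where

    X : ℕ → V
    X t = x (clamp (suc d) t)

    pos : ℕ → Fin (suc m)
    pos t = proj₁ (proj₁ geodesic (clamp d t))

    shift : ∀ {t} → t < suc d → ShiftAt n m (pos t) (X t) (X (suc t))
    shift {t} t<d = subst (λ k → ShiftAt n m (pos t) (x k) (X (suc t)))
      (sym (clamp-inject₁ (s≤s⁻¹ t<d))) (proj₂ (proj₁ geodesic (clamp d t)))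

    shortest : ∀ {e} → e < suc d → ¬ Path (X 0) (X (suc d)) e
    shortest {e} e<d π = proj₂ geodesic e e<d (vertices π) (vertices-walk π) (λ _ → refl)
      (λ c → trans (≈⇒SameVertex (vertices-end π) c) (cong (λ k → coord (x k) c) (clamp-self (suc d))))

    X-toℕ : (k : Fin (suc d)) → X (toℕ k) ≡ x (inject₁ k)
    X-toℕ k = cong x (trans (clamp-inject₁ (s≤s⁻¹ (toℕ<n k))) (cong inject₁ (clamp-toℕ d k)))

    X-suc-toℕ : (k : Fin (suc d)) → X (suc (toℕ k)) ≡ x (fs k)
    X-suc-toℕ k = cong (x ∘ fs) (clamp-toℕ d k)

    left-right-same-step : (k k' : Fin (suc d)) →
      LeftShift n m i (x (inject₁ k)) (x (fs k)) → RightShift n m i (x (inject₁ k')) (x (fs k')) → k ≡ k'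
    left-right-same-step k k' left right = toℕ-injective
      (ShortestWalk.left-right-same-time (suc d) X pos shift shortest (toℕ<n k) (toℕ<n k')
      (subst₂ (LeftShift n m _) (sym (X-toℕ k)) (sym (X-suc-toℕ k)) left)
      (subst₂ (RightShift n m _) (sym (X-toℕ k')) (sym (X-suc-toℕ k')) right))

lemma4p3 : (n : ℕ) .{{_ : NonZero n}} (m d : ℕ) (x : Fin (suc d) → Vertex n m) →
    IsGeodesic n m d x → (i : Fin (suc m)) →
    (∀ (k : Fin d) → ShiftAt n m i (x (inject₁ k)) (x (fs k)) → LeftShift n m i (x (inject₁ k)) (x (fs k)))
    ⊎ (∀ (k : Fin d) → ShiftAt n m i (x (inject₁ k)) (x (fs k)) → RightShift n m i (x (inject₁ k)) (x (fs k)))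
lemma4p3 n m zero x geodesic i = inj₁ λ ()
lemma4p3 n m (suc d) x geodesic i with any? (λ k → YokeGraph.RightShift? n m i (x (inject₁ k)) (x (fs k)))
... | no no-right = inj₁ λ k → [ id , (λ right → ⊥-elim (no-right (k , right))) ]′
... | yes (k₀ , right₀) = inj₂ λ k → [ (λ left → subst (λ k′ → RightShift n m i (x (inject₁ k′)) (x (fs k′)))
                                          (sym (left-right-same-step k k₀ left right₀)) right₀) , id ]′
  where open YokeGraph.Geodesic n m d x geodesic using (left-right-same-step)
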